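{- Let $N=(P,T,F)$ be a Petri net, let $m_{\mathrm{src}},m_{\mathrm{tgt}}\in\mathbb{R}_{\ge0}^P$, and let $\varphi$ be a bi-separator for $(m_{\mathrm{src}},m_{\mathrm{tgt}})$. Then $\psi(m):=\varphi(m_{\mathrm{src}},m)$ is a separator for $(m_{\mathrm{src}},m_{\mathrm{tgt}})$ in $N$, and $\psi'(m):=\varphi(m,m_{\mathrm{tgt}})$ is a separator for $(m_{\mathrm{tgt}},m_{\mathrm{src}})$ in the transpose net $N^\top$.
   Context: A Petri net is $N=(P,T,F)$ with $P,T$ disjoint finite sets and $F=(F_-,F_+)$, $F_\pm\colon P\times T\to\mathbb{N}$. For $t\in T$, ${}^\bullet t:=F_-e_t$, $\Delta_t:=(F_+-F_-)e_t$. Markings are $m\in\mathbb{R}_{\ge0}^P$; for $\alpha>0$, if $m\ge\alpha\,{}^\bullet t$ then $m\xrightarrow{\alpha t}m+\alpha\Delta_t$; $m\to m'$ means $m\xrightarrow{\alpha t}m'$ for some $t\in T$, $\alpha>0$. The transpose net is $N^\top=(P,T,(F_+,F_-))$. A linear formula is a first-order formula over linear inequalities ($a\cdot x\le b$ or $a\cdot x<b$) with variables over $\mathbb{R}_{\ge0}$; $[\![\varphi]\!]$ is its solution set. A separator for $(m_{\mathrm{src}},m_{\mathrm{tgt}})$ (in a net) is a linear formula $\varphi$ over $\mathbb{R}_{\ge0}^P$ with $m_{\mathrm{src}}\in[\![\varphi]\!]$, $m_{\mathrm{tgt}}\notin[\![\varphi]\!]$, and $\varphi$ forward invariant: $m\in[\![\varphi]\!]$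 and $m\to m'$ imply $m'\in[\![\varphi]\!]$. A linear formula $\varphi$ over $\mathbb{R}_{\ge0}^P\times\mathbb{R}_{\ge0}^P$ is forward invariant if $(m,m')\in[\![\varphi]\!]$ and $m'\to m''$ imply $(m,m'')\in[\![\varphi]\!]$; backward invariant if $(m',m'')\in[\![\varphi]\!]$ and $m\to m'$ imply $(m,m'')\in[\![\varphi]\!]$; bi-invariant if both. A bi-separator for $(m_{\mathrm{src}},m_{\mathrm{tgt}})$ is a bi-invariant linear formula $\varphi$ with $(m_{\mathrm{src}},m_{\mathrm{src}})\in[\![\varphi]\!]$, $(m_{\mathrm{tgt}},m_{\mathrm{tgt}})\in[\![\varphi]\!]$ and $(m_{\mathrm{src}},m_{\mathrm{tgt}})\notin[\![\varphi]\!]$. -}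

module Defs where

open import Data.Nat using (ℕ; zero; suc; _+_)
open import Data.Fin using (Fin; splitAt)
open import Data.Sum using (_⊎_; [_,_]′)
open import Data.Product using (Σ; _×_; _,_; ∃)
open import Data.Empty using (⊥)
open import Relation.Nullary using (¬_)
open import Relation.Binary.PropositionalEquality using (_≡_)

record Reals : Set₁ where
  infixl 6 _+ᵣ_
  infixl 7 _*ᵣ_
  infix 4 _≤ᵣ_
  field
    ℝ      : Set
    0ᵣ 1ᵣ  : ℝ
    _+ᵣ_ _*ᵣ_ : ℝ → ℝ → ℝ
    -ᵣ_    : ℝ → ℝ
    _≤ᵣ_   : ℝ → ℝ → Set
    +-assoc   : ∀ x y z → (x +ᵣ y) +ᵣ z ≡ x +ᵣ (y +ᵣ z)
    +-comm    : ∀ x y → x +ᵣ y ≡ y +ᵣ x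
    +-idʳ     : ∀ x → x +ᵣ 0ᵣ ≡ x
    +-invʳ    : ∀ x → x +ᵣ (-ᵣ x) ≡ 0ᵣ
    *-assoc   : ∀ x y z → (x *ᵣ y) *ᵣ z ≡ x *ᵣ (y *ᵣ z)
    *-comm    : ∀ x y → x *ᵣ y ≡ y *ᵣ x
    *-idʳ     : ∀ x → x *ᵣ 1ᵣ ≡ x
    distribˡ  : ∀ x y z → x *ᵣ (y +ᵣ z) ≡ (x *ᵣ y) +ᵣ (x *ᵣ z)
    0≢1       : ¬ (0ᵣ ≡ 1ᵣ)
    *-inv     : ∀ x → ¬ (x ≡ 0ᵣ) → Σ ℝ λ y → x *ᵣ y ≡ 1ᵣ
    ≤-refl    : ∀ x → x ≤ᵣ x
    ≤-trans   : ∀ {x y z} → x ≤ᵣ y → y ≤ᵣ z → x ≤ᵣ z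
    ≤-antisym : ∀ {x y} → x ≤ᵣ y → y ≤ᵣ x → x ≡ y
    ≤-total   : ∀ x y → (x ≤ᵣ y) ⊎ (y ≤ᵣ x)
    +-mono-≤  : ∀ {x y} z → x ≤ᵣ y → x +ᵣ z ≤ᵣ y +ᵣ z
    *-nonneg  : ∀ {x y} → 0ᵣ ≤ᵣ x → 0ᵣ ≤ᵣ y → 0ᵣ ≤ᵣ x *ᵣ y
    complete  : (S : ℝ → Set) → (Σ ℝ S) →
                (Σ ℝ λ b → ∀ x → S x → x ≤ᵣ b) →
                Σ ℝ λ s → (∀ x → S x → x ≤ᵣ s) ×
                          (∀ b → (∀ x → S x → x ≤ᵣ b) → s ≤ᵣ b)

  infix 4 _<ᵣ_
  _<ᵣ_ : ℝ → ℝ → Set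
  x <ᵣ y = (x ≤ᵣ y) × ¬ (x ≡ y)

  infixl 6 _-ᵣ_
  _-ᵣ_ : ℝ → ℝ → ℝ
  x -ᵣ y = x +ᵣ (-ᵣ y)

  ℕ→ℝ : ℕ → ℝ
  ℕ→ℝ zero    = 0ᵣ
  ℕ→ℝ (suc n) = 1ᵣ +ᵣ ℕ→ℝ n

record Net (p t : ℕ) : Set where
  field
    F₋ F₊ : Fin p → Fin t → ℕ

transpose : ∀ {p t} → Net p t → Net p t
transpose N = record { F₋ = Net.F₊ N ; F₊ = Net.F₋ N }

module _ (R : Reals) where
  open Reals R

  Vecᵣ : ℕ → Set
  Vecᵣ n = Fin n → ℝ

  NonNeg : ∀ {n} → Vecᵣ n → Set
  NonNeg m = ∀ i → 0ᵣ ≤ᵣ m i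

  dot : ∀ {n} → Vecᵣ n → Vecᵣ n → ℝ
  dot {zero}  a x = 0ᵣ
  dot {suc n} a x = (a Fin.zero *ᵣ x Fin.zero) +ᵣ dot (λ i → a (Fin.suc i)) (λ i → x (Fin.suc i))

  extend : ∀ {n} → ℝ → Vecᵣ n → Vecᵣ (suc n)
  extend x e Fin.zero    = x
  extend x e (Fin.suc i) = e i

  -- linear formulas with n free variables (de Bruijn: bound variable = index 0)
  data Formula (n : ℕ) : Set where
    atom≤ atom< : Vecᵣ n → ℝ → Formula n
    ¬ᶠ_         : Formula n → Formula n
    _∧ᶠ_ _∨ᶠ_ _⇒ᶠ_ : Formula n → Formula n → Formula n
    ∀ᶠ ∃ᶠ       : Formula (suc n) → Formula n

  -- semantics; all variables range over ℝ≥0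
  ⟦_⟧ : ∀ {n} → Formula n → Vecᵣ n → Set
  ⟦ atom≤ a b ⟧ x = dot a x ≤ᵣ b
  ⟦ atom< a b ⟧ x = dot a x <ᵣ b
  ⟦ ¬ᶠ φ ⟧ x = ¬ ⟦ φ ⟧ x
  ⟦ φ ∧ᶠ ψ ⟧ x = ⟦ φ ⟧ x × ⟦ ψ ⟧ x
  ⟦ φ ∨ᶠ ψ ⟧ x = ⟦ φ ⟧ x ⊎ ⟦ ψ ⟧ x
  ⟦ φ ⇒ᶠ ψ ⟧ x = ⟦ φ ⟧ x → ⟦ ψ ⟧ x
  ⟦ ∀ᶠ φ ⟧ x = (y : ℝ) → 0ᵣ ≤ᵣ y → ⟦ φ ⟧ (extend y x)
  ⟦ ∃ᶠ φ ⟧ x = Σ ℝ λ y → (0ᵣ ≤ᵣ y) × ⟦ φ ⟧ (extend y x)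

  pairᵐ : ∀ {p} → Vecᵣ p → Vecᵣ p → Vecᵣ (p + p)
  pairᵐ {p} m m' i = [ m , m' ]′ (splitAt p i)

  Step : ∀ {p t} → Net p t → Vecᵣ p → Vecᵣ p → Set
  Step {p} {t} N m m' = Σ (Fin t) λ tr → Σ ℝ λ α →
      (0ᵣ <ᵣ α)
    × (∀ i → α *ᵣ ℕ→ℝ (Net.F₋ N i tr) ≤ᵣ m i)
    × (∀ i → m' i ≡ m i +ᵣ α *ᵣ (ℕ→ℝ (Net.F₊ N i tr) -ᵣ ℕ→ℝ (Net.F₋ N i tr)))

  ForwardInvariant : ∀ {p t} → Net p t → Formula p → Set
  ForwardInvariant N φ = ∀ m m' → NonNeg m → NonNeg m' →
    ⟦ φ ⟧ m → Step N m m' → ⟦ φ ⟧ m'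

  record Separator {p t} (N : Net p t) (φ : Formula p) (src tgt : Vecᵣ p) : Set where
    field
      src∈  : ⟦ φ ⟧ src
      tgt∉  : ¬ ⟦ φ ⟧ tgt
      invar : ForwardInvariant N φ

  BiForwardInvariant : ∀ {p t} → Net p t → Formula (p + p) → Set
  BiForwardInvariant N φ = ∀ m m' m'' → NonNeg m → NonNeg m' → NonNeg m'' →
    ⟦ φ ⟧ (pairᵐ m m') → Step N m' m'' → ⟦ φ ⟧ (pairᵐ m m'')

  BiBackwardInvariant : ∀ {p t} → Net p t → Formula (p + p) → Set
  BiBackwardInvariant N φ = ∀ m m' m'' → NonNeg m → NonNeg m' → NonNeg m'' →
    ⟦ φ ⟧ (pairᵐ m' m'') → Step N m m' → ⟦ φ ⟧ (pairᵐ m m'')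

  record BiSeparator {p t} (N : Net p t) (φ : Formula (p + p)) (src tgt : Vecᵣ p) : Set where
    field
      fwd      : BiForwardInvariant N φ
      bwd      : BiBackwardInvariant N φ
      srcsrc∈  : ⟦ φ ⟧ (pairᵐ src src)
      tgttgt∈  : ⟦ φ ⟧ (pairᵐ tgt tgt)
      srctgt∉  : ¬ ⟦ φ ⟧ (pairᵐ src tgt)

{-# OPTIONS --safe #-}
-- Fixing one argument of a linear formula to a constant marking gives again a linear formula,
-- because substituting constants into a linear inequality only shifts its right-hand side.
-- Forward invariance of φ(m_src, ·) is then the forward half of bi-invariance, and forward
-- invariance of φ(·, m_tgt) in the transpose net is the backward half, since every step of
-- the transpose net reverses a step of N.
module Submission where

open import Defs
open import Data.Nat using (ℕ; zero; suc; _+_)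
open import Data.Fin using (Fin; _↑ˡ_; _↑ʳ_)
open import Data.Fin.Properties using (splitAt-↑ˡ; splitAt-↑ʳ)
open import Data.Vec.Functional using (head; tail; _++_)
open import Data.Product using (Σ; _×_; _,_)
open import Data.Product.Function.NonDependent.Propositional using (_×-⇔_)
open import Data.Sum using ([_,_])
open import Data.Sum.Function.Propositional using (_⊎-⇔_)
open import Function using (_∘_)
open import Function.Bundles using (_⇔_; mk⇔; Equivalence)
open import Function.Related.TypeIsomorphisms using (¬-cong-⇔; →-cong-⇔)
open import Relation.Binary.PropositionalEquality
  using (_≡_; refl; sym; trans; cong; cong₂; subst; module ≡-Reasoning)

open Equivalence using (to; from)

module _ (R : Reals) where
  open Reals R

  +-identityˡ : ∀ x → 0ᵣ +ᵣ x ≡ x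
  +-identityˡ x = trans (+-comm 0ᵣ x) (+-idʳ x)

  x-y+y≡x : ∀ x y → (x -ᵣ y) +ᵣ y ≡ x
  x-y+y≡x x y = begin
    (x +ᵣ -ᵣ y) +ᵣ y  ≡⟨ +-assoc x (-ᵣ y) y ⟩
    x +ᵣ (-ᵣ y +ᵣ y)  ≡⟨ cong (x +ᵣ_) (trans (+-comm (-ᵣ y) y) (+-invʳ y)) ⟩
    x +ᵣ 0ᵣ           ≡⟨ +-idʳ x ⟩
    x                 ∎
    where open ≡-Reasoning

  x+y-y≡x : ∀ x y → (x +ᵣ y) -ᵣ y ≡ x
  x+y-y≡x x y = begin
    (x +ᵣ y) +ᵣ -ᵣ y  ≡⟨ +-assoc x y (-ᵣ y) ⟩
    x +ᵣ (y -ᵣ y)     ≡⟨ cong (x +ᵣ_) (+-invʳ y) ⟩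
    x +ᵣ 0ᵣ           ≡⟨ +-idʳ x ⟩
    x                 ∎
    where open ≡-Reasoning

  [x-y]+[y-x]≡0 : ∀ x y → (x -ᵣ y) +ᵣ (y -ᵣ x) ≡ 0ᵣ
  [x-y]+[y-x]≡0 x y = begin
    (x -ᵣ y) +ᵣ (y +ᵣ -ᵣ x)  ≡⟨ sym (+-assoc (x -ᵣ y) y (-ᵣ x)) ⟩
    ((x -ᵣ y) +ᵣ y) -ᵣ x     ≡⟨ cong (_-ᵣ x) (x-y+y≡x x y) ⟩
    x -ᵣ x                   ≡⟨ +-invʳ x ⟩
    0ᵣ                       ∎
    where open ≡-Reasoning

  *-zeroʳ : ∀ x → x *ᵣ 0ᵣ ≡ 0ᵣ
  *-zeroʳ x = begin
    x0                     ≡⟨ sym (x+y-y≡x x0 x0) ⟩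
    (x0 +ᵣ x0) -ᵣ x0       ≡⟨ cong (_-ᵣ x0) (sym (distribˡ x 0ᵣ 0ᵣ)) ⟩
    x *ᵣ (0ᵣ +ᵣ 0ᵣ) -ᵣ x0  ≡⟨ cong (λ z → x *ᵣ z -ᵣ x0) (+-idʳ 0ᵣ) ⟩
    x0 -ᵣ x0               ≡⟨ +-invʳ x0 ⟩
    0ᵣ                     ∎
    where
      open ≡-Reasoning
      x0 = x *ᵣ 0ᵣ

  x≤z-y⇔x+y≤z : ∀ x y z → (x ≤ᵣ z -ᵣ y) ⇔ (x +ᵣ y ≤ᵣ z)
  x≤z-y⇔x+y≤z x y z = mk⇔
    (λ h → subst (x +ᵣ y ≤ᵣ_) (x-y+y≡x z y) (+-mono-≤ y h))
    (λ h → subst (_≤ᵣ z -ᵣ y) (x+y-y≡x x y) (+-mono-≤ (-ᵣ y) h))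

  x≡z-y⇔x+y≡z : ∀ x y z → (x ≡ z -ᵣ y) ⇔ (x +ᵣ y ≡ z)
  x≡z-y⇔x+y≡z x y z = mk⇔
    (λ eq → trans (cong (_+ᵣ y) eq) (x-y+y≡x z y))
    (λ eq → trans (sym (x+y-y≡x x y)) (cong (_-ᵣ y) eq))

  x<z-y⇔x+y<z : ∀ x y z → (x <ᵣ z -ᵣ y) ⇔ (x +ᵣ y <ᵣ z)
  x<z-y⇔x+y<z x y z = x≤z-y⇔x+y≤z x y z ×-⇔ ¬-cong-⇔ (x≡z-y⇔x+y≡z x y z)

  dot-congʳ : ∀ {n} (a : Vecᵣ R n) {x y : Vecᵣ R n} → (∀ i → x i ≡ y i) → dot R a x ≡ dot R a y
  dot-congʳ {zero}  a x≗y = refl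
  dot-congʳ {suc n} a x≗y =
    cong₂ _+ᵣ_ (cong (head a *ᵣ_) (x≗y Fin.zero)) (dot-congʳ (tail a) (x≗y ∘ Fin.suc))

  dot-split : ∀ k {n} (a x : Vecᵣ R (k + n)) →
    dot R a x ≡ dot R (a ∘ (_↑ˡ n)) (x ∘ (_↑ˡ n)) +ᵣ dot R (a ∘ (k ↑ʳ_)) (x ∘ (k ↑ʳ_))
  dot-split zero    a x = sym (+-identityˡ (dot R a x))
  dot-split (suc k) a x = trans (cong (head a *ᵣ head x +ᵣ_) (dot-split k (tail a) (tail x)))
                                (sym (+-assoc _ _ _))

  dot-++ : ∀ {k n} (a : Vecᵣ R (k + n)) (u : Vecᵣ R k) (v : Vecᵣ R n) →
    dot R a (u ++ v) ≡ dot R (a ∘ (_↑ˡ n)) u +ᵣ dot R (a ∘ (k ↑ʳ_)) v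
  dot-++ {k} {n} a u v = trans (dot-split k a (u ++ v)) (cong₂ _+ᵣ_
    (dot-congʳ _ λ i → cong [ u , v ] (splitAt-↑ˡ k i n))
    (dot-congʳ _ λ i → cong [ u , v ] (splitAt-↑ʳ k n i)))

  record Affine (m n : ℕ) : Set where
    field
      apply     : Vecᵣ R m → Vecᵣ R n
      coeff     : Vecᵣ R n → Vecᵣ R m
      offset    : Vecᵣ R n → ℝ
      dot-apply : ∀ a x → dot R a (apply x) ≡ dot R (coeff a) x +ᵣ offset a

  open Affine

  lift : ∀ {m n} → Affine m n → Affine (suc m) (suc n)
  apply     (lift f) x   = extend R (head x) (apply f (tail x))
  coeff     (lift f) a   = extend R (head a) (coeff f (tail a))
  offset    (lift f) a   = offset f (tail a)
  dot-apply (lift f) a x = trans (cong (head a *ᵣ head x +ᵣ_) (dot-apply f (tail a) (tail x)))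
                                 (sym (+-assoc _ _ _))

  preimage : ∀ {m n} → Affine m n → Formula R n → Formula R m
  preimage f (atom≤ a b) = atom≤ (coeff f a) (b -ᵣ offset f a)
  preimage f (atom< a b) = atom< (coeff f a) (b -ᵣ offset f a)
  preimage f (¬ᶠ φ)      = ¬ᶠ preimage f φ
  preimage f (φ ∧ᶠ ψ)    = preimage f φ ∧ᶠ preimage f ψ
  preimage f (φ ∨ᶠ ψ)    = preimage f φ ∨ᶠ preimage f ψ
  preimage f (φ ⇒ᶠ ψ)    = preimage f φ ⇒ᶠ preimage f ψ
  preimage f (∀ᶠ φ)      = ∀ᶠ (preimage (lift f) φ)
  preimage f (∃ᶠ φ)      = ∃ᶠ (preimage (lift f) φ)

  ⟦preimage⟧ : ∀ {m n} (f : Affine m n) (φ : Formula R n) x →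
               ⟦_⟧ R (preimage f φ) x ⇔ ⟦_⟧ R φ (apply f x)
  ⟦preimage⟧ f (atom≤ a b) x = subst (λ s → _ ⇔ (s ≤ᵣ b)) (sym (dot-apply f a x))
                                     (x≤z-y⇔x+y≤z _ _ b)
  ⟦preimage⟧ f (atom< a b) x = subst (λ s → _ ⇔ (s <ᵣ b)) (sym (dot-apply f a x))
                                     (x<z-y⇔x+y<z _ _ b)
  ⟦preimage⟧ f (¬ᶠ φ)   x = ¬-cong-⇔ (⟦preimage⟧ f φ x)
  ⟦preimage⟧ f (φ ∧ᶠ ψ) x = ⟦preimage⟧ f φ x ×-⇔ ⟦preimage⟧ f ψ x
  ⟦preimage⟧ f (φ ∨ᶠ ψ) x = ⟦preimage⟧ f φ x ⊎-⇔ ⟦preimage⟧ f ψ x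
  ⟦preimage⟧ f (φ ⇒ᶠ ψ) x = →-cong-⇔ (⟦preimage⟧ f φ x) (⟦preimage⟧ f ψ x)
  ⟦preimage⟧ f (∀ᶠ φ)   x = mk⇔
    (λ h y y≥0 → to   (⟦preimage⟧ (lift f) φ (extend R y x)) (h y y≥0))
    (λ h y y≥0 → from (⟦preimage⟧ (lift f) φ (extend R y x)) (h y y≥0))
  ⟦preimage⟧ f (∃ᶠ φ)   x = mk⇔
    (λ (y , y≥0 , h) → y , y≥0 , to   (⟦preimage⟧ (lift f) φ (extend R y x)) h)
    (λ (y , y≥0 , h) → y , y≥0 , from (⟦preimage⟧ (lift f) φ (extend R y x)) h)

  prepend : ∀ {k n} → Vecᵣ R k → Affine n (k + n)
  apply     (prepend {k} {n} c) x   = c ++ x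
  coeff     (prepend {k} {n} c) a   = a ∘ (k ↑ʳ_)
  offset    (prepend {k} {n} c) a   = dot R (a ∘ (_↑ˡ n)) c
  dot-apply (prepend {k} {n} c) a x = trans (dot-++ a c x) (+-comm _ _)

  append : ∀ {k n} → Vecᵣ R n → Affine k (k + n)
  apply     (append {k} {n} c) x   = x ++ c
  coeff     (append {k} {n} c) a   = a ∘ (_↑ˡ n)
  offset    (append {k} {n} c) a   = dot R (a ∘ (k ↑ʳ_)) c
  dot-apply (append {k} {n} c) a x = dot-++ a x c

  undo-update : ∀ {x x′} α a b → x′ ≡ x +ᵣ α *ᵣ (a -ᵣ b) → x ≡ x′ +ᵣ α *ᵣ (b -ᵣ a)
  undo-update {x} {x′} α a b x′≡ = sym (begin
    x′ +ᵣ α *ᵣ (b -ᵣ a)                     ≡⟨ cong (_+ᵣ α *ᵣ (b -ᵣ a)) x′≡ ⟩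
    (x +ᵣ α *ᵣ (a -ᵣ b)) +ᵣ α *ᵣ (b -ᵣ a)   ≡⟨ +-assoc x _ _ ⟩
    x +ᵣ (α *ᵣ (a -ᵣ b) +ᵣ α *ᵣ (b -ᵣ a))   ≡⟨ cong (x +ᵣ_) (sym (distribˡ α _ _)) ⟩
    x +ᵣ α *ᵣ ((a -ᵣ b) +ᵣ (b -ᵣ a))        ≡⟨ cong (λ z → x +ᵣ α *ᵣ z) ([x-y]+[y-x]≡0 a b) ⟩
    x +ᵣ α *ᵣ 0ᵣ                            ≡⟨ cong (x +ᵣ_) (*-zeroʳ α) ⟩
    x +ᵣ 0ᵣ                                 ≡⟨ +-idʳ x ⟩
    x                                       ∎)
    where open ≡-Reasoning

  enabled-after-update : ∀ {x} α a b → α *ᵣ b ≤ᵣ x → α *ᵣ a ≤ᵣ x +ᵣ α *ᵣ (a -ᵣ b)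
  enabled-after-update {x} α a b αb≤x = subst (_≤ᵣ x +ᵣ α *ᵣ (a -ᵣ b)) αb+α[a-b]≡αa
    (+-mono-≤ (α *ᵣ (a -ᵣ b)) αb≤x)
    where
      αb+α[a-b]≡αa : α *ᵣ b +ᵣ α *ᵣ (a -ᵣ b) ≡ α *ᵣ a
      αb+α[a-b]≡αa = trans (sym (distribˡ α b (a -ᵣ b)))
                           (cong (α *ᵣ_) (trans (+-comm b (a -ᵣ b)) (x-y+y≡x a b)))

  step-transpose : ∀ {p t} (N : Net p t) {m m′} → Step R (transpose N) m m′ → Step R N m′ m
  step-transpose {p} N (tr , α , α>0 , enabled , m′≡) =
    tr , α , α>0 ,
    (λ i → subst (_ ≤ᵣ_) (sym (m′≡ i)) (enabled-after-update α (F₋ i) (F₊ i) (enabled i))) ,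
    (λ i → undo-update α (F₋ i) (F₊ i) (m′≡ i))
    where
      F₋ F₊ : Fin p → ℝ
      F₋ i = ℕ→ℝ (Net.F₋ N i tr)
      F₊ i = ℕ→ℝ (Net.F₊ N i tr)

  biForward⇒forward : ∀ {p t} (N : Net p t) {φ : Formula R (p + p)} {ψ : Formula R p} {s} →
    BiForwardInvariant R N φ → NonNeg R s →
    (∀ m → ⟦_⟧ R ψ m ⇔ ⟦_⟧ R φ (pairᵐ R s m)) → ForwardInvariant R N ψ
  biForward⇒forward N {s = s} fwd s≥0 ψ⇔ m m′ m≥0 m′≥0 ψm step =
    from (ψ⇔ m′) (fwd s m m′ s≥0 m≥0 m′≥0 (to (ψ⇔ m) ψm) step)

  biBackward⇒transposeForward : ∀ {p t} (N : Net p t) {φ : Formula R (p + p)} {ψ : Formula R p} {s} →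
    BiBackwardInvariant R N φ → NonNeg R s →
    (∀ m → ⟦_⟧ R ψ m ⇔ ⟦_⟧ R φ (pairᵐ R m s)) → ForwardInvariant R (transpose N) ψ
  biBackward⇒transposeForward N {s = s} bwd s≥0 ψ⇔ m m′ m≥0 m′≥0 ψm step =
    from (ψ⇔ m′) (bwd m′ m s m′≥0 m≥0 s≥0 (to (ψ⇔ m) ψm) (step-transpose N step))

proposition2p4 : (R : Reals) → ∀ {p t} (N : Net p t) (src tgt : Vecᵣ R p) →
    NonNeg R src → NonNeg R tgt → (φ : Formula R (p + p)) →
    BiSeparator R N φ src tgt →
    (Σ (Formula R p) λ ψ →
        (∀ m → ⟦_⟧ R ψ m ⇔ ⟦_⟧ R φ (pairᵐ R src m)) × Separator R N ψ src tgt)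
    × (Σ (Formula R p) λ ψ′ →
        (∀ m → ⟦_⟧ R ψ′ m ⇔ ⟦_⟧ R φ (pairᵐ R m tgt)) × Separator R (transpose N) ψ′ tgt src)
proposition2p4 R {p} N src tgt src≥0 tgt≥0 φ bisep =
  (ψ , ψ⇔ , record
    { src∈  = from (ψ⇔ src) srcsrc∈
    ; tgt∉  = srctgt∉ ∘ to (ψ⇔ tgt)
    ; invar = biForward⇒forward R N {φ} {ψ} fwd src≥0 ψ⇔ }) ,
  (ψ′ , ψ′⇔ , record
    { src∈  = from (ψ′⇔ tgt) tgttgt∈
    ; tgt∉  = srctgt∉ ∘ to (ψ′⇔ src)
    ; invar = biBackward⇒transposeForward R N {φ} {ψ′} bwd tgt≥0 ψ′⇔ })
  where
    open BiSeparator bisep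
    ψ ψ′ : Formula R p
    ψ  = preimage R (prepend R src) φ
    ψ′ = preimage R (append R tgt) φ
    ψ⇔ : ∀ m → ⟦_⟧ R ψ m ⇔ ⟦_⟧ R φ (pairᵐ R src m)
    ψ⇔  = ⟦preimage⟧ R (prepend R src) φ
    ψ′⇔ : ∀ m → ⟦_⟧ R ψ′ m ⇔ ⟦_⟧ R φ (pairᵐ R m tgt)
    ψ′⇔ = ⟦preimage⟧ R (append R tgt) φ
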